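{- Let $n\ge1$, let $t$ be an integer with $1\le t\le n$, and let $G=(V,E)$ be the star graph with $V=\{1,\dots,n+1\}$ and $E=\{\{n+1,i\}: i=1,\dots,n\}$. Then the level-1 Sherali–Adams tightening $\mathcal S^{(1)}(P_t(G))$ has integrality gap $1$ for the unweighted objective: $\min\{\sum_{i\in V}x_i: x\in\mathcal S^{(1)}(P_t(G))\}$ equals the minimum size of a $t$-partial vertex cover of $G$ (which is $1$).
   Context: A $t$-partial vertex cover of $G=(V,E)$ is a set $S\subseteq V$ such that at least $t$ edges have an endpoint in $S$. $P_t(G)\subseteq[0,1]^m$, with ground set $[m]=V\cup E$, is the set of $x$ satisfying $x_i+x_j\ge x_e$ for every edge $e=\{i,j\}$, $\sum_{e\in E}x_e\ge t$, and $0\le x_q\le1$ for all $q\in V\cup E$. Sherali–Adams: for $P\subseteq[0,1]^m$ given by constraints $a^Tx\ge b$, its homogenization $K$ is the cone of $\bar x\in\mathbb R^{\{\emptyset\}\cup[m]}$ with $\bar x_\emptyset\ge0$ and $a^T\bar x\ge b\bar x_\emptyset$. $\mathcal P_r$ = subsets of $[m]$ of size at most $r$. For $y\in\mathbb R^{\mathcal P_{r+1}}$ the moment matrix $\mathcal Y$ has rows indexed by $\mathcal P_1$, columns by $\mathcal P_r$, $\mathcal Y_{A,B}=y_{A\cup B}$; $\mathbf e_I$ are standard basis vectors. $M^{(r)}$ is the set of $x\in\mathbb R^{\mathcal P_1}$ for which there is $y\in\mathbb R^{\mathcal P_{r+1}}$ with $\mathcal Y\mathbf e_\emptyset=x$ and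 $\mathcal Y\sum_{T\subseteq N}(-1)^{|T|}\mathbf e_{Y\cup T}\in K$ for all $Y,N$ with $Y\cup N\in\mathcal P_r$; and $\mathcal S^{(r)}(P)=M^{(r)}\cap\{x_\emptyset=1\}$, viewed as a subset of $[0,1]^m$. -}

module Defs where

open import Data.Nat as ℕ using (ℕ; zero; suc)
open import Data.Integer using (+_)
open import Data.Fin using (Fin; _↑ˡ_; _↑ʳ_; fromℕ; inject₁; splitAt; _≟_)
open import Data.Fin.Subset using (Subset; ⊥; ⁅_⁆; _∪_; ∣_∣)
open import Data.Vec using (Vec; []; _∷_; lookup)
open import Data.Bool using (Bool; true; false; _∨_; if_then_else_)
open import Data.List as List using (List; []; _∷_; map; _++_; foldr; allFin; concatMap)
open import Data.List.Relation.Unary.All using (All)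
open import Data.Nat.ListAction using () renaming (sum to sumℕ)
open import Data.Rational using (ℚ; 0ℚ; 1ℚ; _+_; _*_; -_; _≤_; _/_)
open import Data.Product using (Σ; Σ-syntax; _×_; _,_; proj₁; proj₂)
open import Data.Sum using ([_,_])
open import Relation.Nullary.Decidable using (⌊_⌋)
open import Relation.Binary.PropositionalEquality using (_≡_)

ℕ→ℚ : ℕ → ℚ
ℕ→ℚ k = (+ k) / 1

sumℚ : List ℚ → ℚ
sumℚ = foldr _+_ 0ℚ

Σℚ : ∀ {m} → (Fin m → ℚ) → ℚ
Σℚ {m} f = sumℚ (map f (allFin m))

sign : ℕ → ℚ
sign zero = 1ℚ
sign (suc k) = - sign k

subsetsOf : ∀ {m} → Subset m → List (Subset m)
subsetsOf [] = [] ∷ []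
subsetsOf (false ∷ N) = map (false ∷_) (subsetsOf N)
subsetsOf (true ∷ N) = map (false ∷_) (subsetsOf N) ++ map (true ∷_) (subsetsOf N)

record Constraint (m : ℕ) : Set where
  constructor ⟨_,_⟩
  field
    coef : Fin m → ℚ
    rhs  : ℚ
open Constraint public

-- homogenization cone K: z∅ ≥ 0 and a^T z ≥ b z∅ for every constraint
InK : ∀ {m} → List (Constraint m) → ℚ → (Fin m → ℚ) → Set
InK cs z∅ z = (0ℚ ≤ z∅) × All (λ c → rhs c * z∅ ≤ Σℚ (λ i → coef c i * z i)) cs

-- (𝒴 Σ_{T⊆N} (-1)^{|T|} e_{Y∪T})_A = Σ_{T⊆N} (-1)^{|T|} y_{A∪Y∪T}
column : ∀ {m} → (Subset m → ℚ) → Subset m → Subset m → Subset m → ℚ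
column y Y N A = sumℚ (map (λ T → sign ∣ T ∣ * y (A ∪ (Y ∪ T))) (subsetsOf N))

-- x ∈ 𝒮^(r)(P), P given by the constraint list cs.
-- y is a total function on subsets; only its values on 𝒫_{r+1} are used.
SA : ∀ {m} → ℕ → List (Constraint m) → (Fin m → ℚ) → Set
SA {m} r cs x =
  Σ[ y ∈ (Subset m → ℚ) ]
    (y ⊥ ≡ 1ℚ)
    × (∀ i → y ⁅ i ⁆ ≡ x i)
    × (∀ (Y N : Subset m) → ∣ Y ∪ N ∣ ℕ.≤ r →
         InK cs (column y Y N ⊥) (λ i → column y Y N ⁅ i ⁆))

record Graph : Set where
  field
    nV nE : ℕ
    ends  : Fin nE → Fin nV × Fin nV
open Graph public

-- ground set V ∪ E = Fin (nV + nE)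
Ground : Graph → ℕ
Ground G = nV G ℕ.+ nE G

vtx : (G : Graph) → Fin (nV G) → Fin (Ground G)
vtx G v = v ↑ˡ nE G

edg : (G : Graph) → Fin (nE G) → Fin (Ground G)
edg G e = nV G ↑ʳ e

ind : ∀ {m} → Fin m → Fin m → ℚ
ind p q = if ⌊ p ≟ q ⌋ then 1ℚ else 0ℚ

-- constraints of P_t(G):  x_i + x_j - x_e ≥ 0 (e = {i,j}),  Σ_e x_e ≥ t,
-- x_q ≥ 0 and -x_q ≥ -1 for all q ∈ V ∪ E
PtConstraints : (G : Graph) → ℕ → List (Constraint (Ground G))
PtConstraints G t =
  map edgeC (allFin (nE G))
  ++ ⟨ isEdge , ℕ→ℚ t ⟩
  ∷ concatMap (λ q → ⟨ ind q , 0ℚ ⟩ ∷ ⟨ (λ p → - ind q p) , - 1ℚ ⟩ ∷ []) (allFin (Ground G))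
  where
  edgeC : Fin (nE G) → Constraint (Ground G)
  edgeC e = ⟨ (λ p → ind (vtx G (proj₁ (ends G e))) p + ind (vtx G (proj₂ (ends G e))) p
                        + - ind (edg G e) p) , 0ℚ ⟩
  isEdge : Fin (Ground G) → ℚ
  isEdge p = [ (λ _ → 0ℚ) , (λ _ → 1ℚ) ] (splitAt (nV G) p)

vertexSum : (G : Graph) → (Fin (Ground G) → ℚ) → ℚ
vertexSum G x = Σℚ (λ v → x (vtx G v))

covered : (G : Graph) → Subset (nV G) → ℕ
covered G S = sumℕ (map (λ e → if lookup S (proj₁ (ends G e)) ∨ lookup S (proj₂ (ends G e))
                                     then 1 else 0) (allFin (nE G)))

IsPartialVC : (G : Graph) → ℕ → Subset (nV G) → Set
IsPartialVC G t S = t ℕ.≤ covered G S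

IsMinPVCSize : Graph → ℕ → ℕ → Set
IsMinPVCSize G t k =
  (Σ[ S ∈ Subset (nV G) ] IsPartialVC G t S × ∣ S ∣ ≡ k)
  × (∀ S → IsPartialVC G t S → k ℕ.≤ ∣ S ∣)

SAMinEquals : ℕ → (G : Graph) → ℕ → ℚ → Set
SAMinEquals r G t q =
  (Σ[ x ∈ (Fin (Ground G) → ℚ) ] SA r (PtConstraints G t) x × vertexSum G x ≡ q)
  × (∀ x → SA r (PtConstraints G t) x → q ≤ vertexSum G x)

-- star graph: vertices 1..n+1 (Fin (suc n), center = fromℕ n),
-- edges {n+1, i} for i = 1..n
star : ℕ → Graph
star n = record { nV = suc n ; nE = n ; ends = λ i → fromℕ n , inject₁ i }

{-# OPTIONS --safe #-}
module Submission where

-- Let x ∈ 𝒮⁽¹⁾(P_t(star n)) have moment vector y and let c be the centre.  The columns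
-- 𝒴(e_∅ − e_c) = (1 − x_c, x_q − y_{qc}) and 𝒴 e_c = (x_c, y_{qc}) lie in the cone K.  The first one
-- vanishes at c, so its edge constraint bounds its value on the edge {c, i} by x_i − y_{ic}, which is
-- at most x_i because the second column is nonnegative; its covering constraint, with t ≥ 1, then
-- gives 1 − x_c ≤ Σ_i x_i.
--
-- A 0/1 point s of a polytope P lies in every 𝒮⁽ʳ⁾(P): its moments y_A = [A ⊆ s] are
-- multiplicative, so every column of 𝒴 is a nonnegative multiple of (1, s).  The centre together with
-- all edges is such a point of P_t(star n), of vertex sum 1, while a t-partial vertex cover with t ≥ 1
-- is nonempty.

open import Defs

module Lemmas where

  open import Algebra.Bundles using (CommutativeMonoid; Ring)
  open import Data.Bool using (Bool; true; false; not; _∧_; _∨_; if_then_else_)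
  open import Data.Bool.Properties using (∧-commutativeMonoid; ∧-identityʳ; ∧-idem)
  open import Data.Fin as Fin using (Fin; zero; suc; _↑ˡ_; _↑ʳ_; splitAt)
  open import Data.Fin.Properties using (splitAt-↑ˡ; splitAt-↑ʳ)
  open import Data.Fin.Subset using (Subset; ⊥; ⁅_⁆; _∪_; ∣_∣)
  open import Data.Fin.Subset.Properties using (∣⊥∣≡0; ∣⁅x⁆∣≡1; x∈⁅x⁆; ∪-identityˡ; ∪-identityʳ; ∪-idem)
  import Data.Integer as ℤ
  import Data.Integer.Properties as ℤ
  open import Data.List as List using (List; []; _∷_; _++_; map; allFin)
  open import Data.List.Properties using (map-cong; map-tabulate; map-∘; map-++; length-tabulate)
  open import Data.List.Relation.Unary.All as All using (All; []; _∷_)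
  open import Data.List.Relation.Unary.All.Properties
    using (++⁺; ++⁻ˡ; ++⁻ʳ; map⁺; map⁻; concat⁺; concat⁻; tabulate⁺; tabulate⁻)
  open import Data.Nat as ℕ using (ℕ; zero; suc)
  open import Data.Nat.Coprimality using (1-coprimeTo) renaming (sym to coprime-sym)
  open import Data.Nat.ListAction using () renaming (sum to sumℕ)
  import Data.Nat.Properties as ℕ
  open import Data.Product using (_,_; proj₁; proj₂)
  open import Data.Rational as ℚ using (ℚ; mkℚ; 0ℚ; 1ℚ; _+_; _*_; -_; _-_; _≤_; *≤*)
  open import Data.Rational.Properties
  open import Data.Rational.Solver using (module +-*-Solver)
  open +-*-Solver using (solve; _:+_; _:*_; :-_; _:-_; _:=_; con)
  open import Data.Sum using ([_,_])
  open import Data.Vec as Vec using ([]; _∷_)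
  open import Data.Vec.Properties using (lookup∘tabulate; lookup-replicate; []=⇒lookup)
  open import Data.Vec.Functional using (Vector; replicate)
  open import Function using (_∘_; id)
  open import Relation.Binary.PropositionalEquality hiding ([_])
  open import Relation.Nullary using (yes; no)

  open import Algebra.Properties.Semiring.Sum (Ring.semiring +-*-ring)
    using (sum; sum-cong-≗; sum-replicate-zero; ∑-distrib-+; sum-init-last; *-distribʳ-sum)
  open import Algebra.Properties.CommutativeSemigroup (CommutativeMonoid.commutativeSemigroup ∧-commutativeMonoid)
    using () renaming (interchange to ∧-interchange)

  ℕ→ℚ≡mkℚ : ∀ k → ℕ→ℚ k ≡ mkℚ (ℤ.+ k) 0 (coprime-sym (1-coprimeTo k))
  ℕ→ℚ≡mkℚ k = normalize-coprime (coprime-sym (1-coprimeTo k))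

  ℕ→ℚ-suc : ∀ k → ℕ→ℚ (suc k) ≡ 1ℚ + ℕ→ℚ k
  ℕ→ℚ-suc k rewrite ℕ→ℚ≡mkℚ k =
    /-cong {p₁ = ℤ.+ suc k} (cong (ℤ._+_ (ℤ.+ 1)) (sym (ℤ.*-identityʳ (ℤ.+ k)))) refl

  ℕ→ℚ-+ : ∀ a b → ℕ→ℚ (a ℕ.+ b) ≡ ℕ→ℚ a + ℕ→ℚ b
  ℕ→ℚ-+ zero b = sym (+-identityˡ (ℕ→ℚ b))
  ℕ→ℚ-+ (suc a) b = begin
    ℕ→ℚ (suc (a ℕ.+ b))         ≡⟨ ℕ→ℚ-suc (a ℕ.+ b) ⟩
    1ℚ + ℕ→ℚ (a ℕ.+ b)          ≡⟨ cong (1ℚ +_) (ℕ→ℚ-+ a b) ⟩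
    1ℚ + (ℕ→ℚ a + ℕ→ℚ b)        ≡⟨ +-assoc 1ℚ (ℕ→ℚ a) (ℕ→ℚ b) ⟨
    1ℚ + ℕ→ℚ a + ℕ→ℚ b          ≡⟨ cong (_+ ℕ→ℚ b) (ℕ→ℚ-suc a) ⟨
    ℕ→ℚ (suc a) + ℕ→ℚ b         ∎
    where open ≡-Reasoning

  ℕ→ℚ-sum : ∀ xs → ℕ→ℚ (sumℕ xs) ≡ sumℚ (map ℕ→ℚ xs)
  ℕ→ℚ-sum [] = refl
  ℕ→ℚ-sum (x ∷ xs) = trans (ℕ→ℚ-+ x (sumℕ xs)) (cong (ℕ→ℚ x +_) (ℕ→ℚ-sum xs))

  ℕ→ℚ-mono-≤ : ∀ {a b} → a ℕ.≤ b → ℕ→ℚ a ≤ ℕ→ℚ b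
  ℕ→ℚ-mono-≤ {a} {b} a≤b rewrite ℕ→ℚ≡mkℚ a | ℕ→ℚ≡mkℚ b =
    *≤* (subst₂ ℤ._≤_ (sym (ℤ.*-identityʳ (ℤ.+ a))) (sym (ℤ.*-identityʳ (ℤ.+ b))) (ℤ.+≤+ a≤b))

  p-q+q≡p : ∀ p q → p - q + q ≡ p
  p-q+q≡p p q = begin
    p - q + q     ≡⟨ +-assoc p (- q) q ⟩
    p + (- q + q) ≡⟨ cong (p +_) (+-inverseˡ q) ⟩
    p + 0ℚ        ≡⟨ +-identityʳ p ⟩
    p             ∎
    where open ≡-Reasoning

  0≤p-q⇒q≤p : ∀ {p q} → 0ℚ ≤ p - q → q ≤ p
  0≤p-q⇒q≤p {p} {q} 0≤p-q = subst₂ _≤_ (+-identityˡ q) (p-q+q≡p p q) (+-monoˡ-≤ q 0≤p-q)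

  q≤p⇒0≤p-q : ∀ {p q} → q ≤ p → 0ℚ ≤ p - q
  q≤p⇒0≤p-q {p} {q} q≤p = subst (_≤ p - q) (+-inverseʳ q) (+-monoˡ-≤ (- q) q≤p)

  p-q≤r⇒p≤r+q : ∀ {p q r} → p - q ≤ r → p ≤ r + q
  p-q≤r⇒p≤r+q {p} {q} p-q≤r = subst (_≤ _) (p-q+q≡p p q) (+-monoˡ-≤ q p-q≤r)

  0≤q⇒p-q≤p : ∀ p {q} → 0ℚ ≤ q → p - q ≤ p
  0≤q⇒p-q≤p p 0≤q = subst (p - _ ≤_) (+-identityʳ p) (+-monoʳ-≤ p (neg-antimono-≤ 0≤q))

  0≤p*q : ∀ {p q} → 0ℚ ≤ p → 0ℚ ≤ q → 0ℚ ≤ p * q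
  0≤p*q {p} {q} 0≤p 0≤q = subst (_≤ p * q) (*-zeroʳ p) (*-monoˡ-≤-nonNeg p {{ℚ.nonNegative 0≤p}} 0≤q)

  𝟙 : Bool → ℚ
  𝟙 b = if b then 1ℚ else 0ℚ

  0≤𝟙 : ∀ b → 0ℚ ≤ 𝟙 b
  0≤𝟙 true = ≤ᵇ⇒≤ _
  0≤𝟙 false = ≤-refl

  𝟙≤1 : ∀ b → 𝟙 b ≤ 1ℚ
  𝟙≤1 true = ≤-refl
  𝟙≤1 false = ≤ᵇ⇒≤ _

  𝟙-∧ : ∀ a b → 𝟙 (a ∧ b) ≡ 𝟙 a * 𝟙 b
  𝟙-∧ true b = sym (*-identityˡ (𝟙 b))
  𝟙-∧ false b = sym (*-zeroˡ (𝟙 b))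

  𝟙-∨-≤ : ∀ a b → 𝟙 (a ∨ b) ≤ 𝟙 a + 𝟙 b
  𝟙-∨-≤ true true = ≤ᵇ⇒≤ _
  𝟙-∨-≤ true false = ≤-refl
  𝟙-∨-≤ false b = ≤-reflexive (sym (+-identityˡ (𝟙 b)))

  Σℚ≡sum : ∀ {m} (f : Vector ℚ m) → Σℚ f ≡ sum f
  Σℚ≡sum {zero} f = refl
  Σℚ≡sum {suc m} f = cong (f zero +_) (begin
    sumℚ (map f (List.tabulate suc))          ≡⟨ cong sumℚ (map-tabulate suc f) ⟩
    sumℚ (List.tabulate (f ∘ suc))            ≡⟨ cong sumℚ (map-tabulate id (f ∘ suc)) ⟨
    Σℚ (f ∘ suc)                              ≡⟨ Σℚ≡sum (f ∘ suc) ⟩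
    sum (f ∘ suc)                             ∎)
    where open ≡-Reasoning

  Σℚ-cong : ∀ {m} {f g : Vector ℚ m} → (∀ i → f i ≡ g i) → Σℚ f ≡ Σℚ g
  Σℚ-cong {m} f≗g = cong sumℚ (map-cong f≗g (allFin m))

  sum-neg : ∀ {m} (f : Vector ℚ m) → sum (λ i → - f i) ≡ - sum f
  sum-neg {zero} f = refl
  sum-neg {suc m} f = trans (cong (- f zero +_) (sum-neg (f ∘ suc))) (sym (neg-distrib-+ (f zero) _))

  sum-mono-≤ : ∀ {m} {f g : Vector ℚ m} → (∀ i → f i ≤ g i) → sum f ≤ sum g
  sum-mono-≤ {zero} f≤g = ≤-refl
  sum-mono-≤ {suc m} f≤g = +-mono-≤ (f≤g zero) (sum-mono-≤ (f≤g ∘ suc))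

  sum-ind* : ∀ {m} (q : Fin m) (f : Vector ℚ m) → sum (λ p → ind q p * f p) ≡ f q
  sum-ind* {suc m} zero f = begin
    1ℚ * f zero + sum (λ p → 0ℚ * f (suc p))
      ≡⟨ cong₂ _+_ (*-identityˡ (f zero)) (sum-cong-≗ (*-zeroˡ ∘ f ∘ suc)) ⟩
    f zero + sum (replicate m 0ℚ)  ≡⟨ cong (f zero +_) (sum-replicate-zero m) ⟩
    f zero + 0ℚ                    ≡⟨ +-identityʳ (f zero) ⟩
    f zero                         ∎
    where open ≡-Reasoning
  sum-ind* (suc q) f = begin
    0ℚ * f zero + sum (λ p → ind (suc q) (suc p) * f (suc p))
      ≡⟨ cong₂ _+_ (*-zeroˡ (f zero)) (sum-cong-≗ ind-suc*) ⟩
    0ℚ + sum (λ p → ind q p * f (suc p))  ≡⟨ +-identityˡ _ ⟩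
    sum (λ p → ind q p * f (suc p))       ≡⟨ sum-ind* q (f ∘ suc) ⟩
    f (suc q)                             ∎
    where
    open ≡-Reasoning
    ind-suc* : ∀ p → ind (suc q) (suc p) * f (suc p) ≡ ind q p * f (suc p)
    ind-suc* p with q Fin.≟ p
    ... | yes _ = refl
    ... | no _ = refl

  sum-↑ : ∀ a {b} (f : Vector ℚ (a ℕ.+ b)) → sum f ≡ sum (λ i → f (i ↑ˡ b)) + sum (λ j → f (a ↑ʳ j))
  sum-↑ zero f = sym (+-identityˡ (sum f))
  sum-↑ (suc a) f = trans (cong (f zero +_) (sum-↑ a (f ∘ suc))) (sym (+-assoc (f zero) _ _))

  sum-𝟙-lookup : ∀ {m} (S : Subset m) → sum (𝟙 ∘ Vec.lookup S) ≡ ℕ→ℚ ∣ S ∣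
  sum-𝟙-lookup [] = refl
  sum-𝟙-lookup (true ∷ S) = trans (cong (1ℚ +_) (sum-𝟙-lookup S)) (sym (ℕ→ℚ-suc ∣ S ∣))
  sum-𝟙-lookup (false ∷ S) = trans (+-identityˡ _) (sum-𝟙-lookup S)

  sumℚ-++ : ∀ xs ys → sumℚ (xs ++ ys) ≡ sumℚ xs + sumℚ ys
  sumℚ-++ [] ys = sym (+-identityˡ (sumℚ ys))
  sumℚ-++ (x ∷ xs) ys = trans (cong (x +_) (sumℚ-++ xs ys)) (sym (+-assoc x (sumℚ xs) (sumℚ ys)))

  sumℚ-map-*ˡ : ∀ {A : Set} k (f : A → ℚ) xs → sumℚ (map (λ a → k * f a) xs) ≡ k * sumℚ (map f xs)
  sumℚ-map-*ˡ k f [] = sym (*-zeroʳ k)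
  sumℚ-map-*ˡ k f (x ∷ xs) = trans (cong (k * f x +_) (sumℚ-map-*ˡ k f xs)) (sym (*-distribˡ-+ k (f x) _))

  sumℕ-map-const : ∀ {A : Set} {f : A → ℕ} {k} → (∀ a → f a ≡ k) →
    ∀ xs → sumℕ (map f xs) ≡ List.length xs ℕ.* k
  sumℕ-map-const f≡k [] = refl
  sumℕ-map-const f≡k (x ∷ xs) = cong₂ ℕ._+_ (f≡k x) (sumℕ-map-const f≡k xs)

  Σℚ-ind* : ∀ {m} (q : Fin m) (f : Vector ℚ m) → Σℚ (λ p → ind q p * f p) ≡ f q
  Σℚ-ind* q f = trans (Σℚ≡sum (λ p → ind q p * f p)) (sum-ind* q f)

  Σℚ-neg-ind* : ∀ {m} (q : Fin m) (f : Vector ℚ m) → Σℚ (λ p → - ind q p * f p) ≡ - f q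
  Σℚ-neg-ind* q f = begin
    Σℚ (λ p → - ind q p * f p)   ≡⟨ Σℚ≡sum (λ p → - ind q p * f p) ⟩
    sum (λ p → - ind q p * f p)  ≡⟨ sum-cong-≗ (λ p → sym (neg-distribˡ-* (ind q p) (f p))) ⟩
    sum (λ p → - (ind q p * f p)) ≡⟨ sum-neg (λ p → ind q p * f p) ⟩
    - sum (λ p → ind q p * f p)  ≡⟨ cong -_ (sum-ind* q f) ⟩
    - f q                        ∎
    where open ≡-Reasoning

  Σℚ-edge : ∀ {m} (a b e : Fin m) (z : Vector ℚ m) →
    Σℚ (λ p → (ind a p + ind b p + - ind e p) * z p) ≡ z a + z b - z e
  Σℚ-edge a b e z = begin
    Σℚ (λ p → (ind a p + ind b p + - ind e p) * z p)
      ≡⟨ Σℚ≡sum (λ p → (ind a p + ind b p + - ind e p) * z p) ⟩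
    sum (λ p → (ind a p + ind b p + - ind e p) * z p)
      ≡⟨ sum-cong-≗ distrib ⟩
    sum (λ p → a* p + b* p + - e* p)
      ≡⟨ ∑-distrib-+ (λ p → a* p + b* p) (λ p → - e* p) ⟩
    sum (λ p → a* p + b* p) + sum (λ p → - e* p)
      ≡⟨ cong₂ _+_ (∑-distrib-+ a* b*) (sum-neg e*) ⟩
    sum a* + sum b* - sum e*
      ≡⟨ cong₂ _-_ (cong₂ _+_ (sum-ind* a z) (sum-ind* b z)) (sum-ind* e z) ⟩
    z a + z b - z e
      ∎
    where
    open ≡-Reasoning
    a* b* e* : Vector ℚ _
    a* p = ind a p * z p
    b* p = ind b p * z p
    e* p = ind e p * z p
    distrib : ∀ p → (ind a p + ind b p + - ind e p) * z p ≡ ind a p * z p + ind b p * z p + - (ind e p * z p)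
    distrib p = solve 4 (λ u v w x → (u :+ v :- w) :* x := u :* x :+ v :* x :- w :* x) refl
      (ind a p) (ind b p) (ind e p) (z p)

  Σℚ-isEdge : ∀ (G : Graph) (z : Vector ℚ (Ground G)) →
    Σℚ (λ p → [ (λ _ → 0ℚ) , (λ _ → 1ℚ) ] (splitAt (nV G) p) * z p) ≡ Σℚ (λ e → z (edg G e))
  Σℚ-isEdge G z = begin
    Σℚ (λ p → isEdge p * z p)             ≡⟨ Σℚ≡sum (λ p → isEdge p * z p) ⟩
    sum (λ p → isEdge p * z p)            ≡⟨ sum-↑ (nV G) (λ p → isEdge p * z p) ⟩
    sum (λ v → isEdge (vtx G v) * z (vtx G v)) + sum (λ e → isEdge (edg G e) * z (edg G e))
      ≡⟨ cong₂ _+_ (sum-cong-≗ onVertices) (sum-cong-≗ onEdges) ⟩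
    sum (replicate (nV G) 0ℚ) + sum z∘edg ≡⟨ cong (_+ sum z∘edg) (sum-replicate-zero (nV G)) ⟩
    0ℚ + sum z∘edg                        ≡⟨ +-identityˡ (sum z∘edg) ⟩
    sum z∘edg                             ≡⟨ Σℚ≡sum z∘edg ⟨
    Σℚ z∘edg                              ∎
    where
    open ≡-Reasoning
    z∘edg : Vector ℚ (nE G)
    z∘edg = z ∘ edg G
    isEdge : Fin (Ground G) → ℚ
    isEdge p = [ (λ _ → 0ℚ) , (λ _ → 1ℚ) ] (splitAt (nV G) p)
    onVertices : ∀ v → isEdge (vtx G v) * z (vtx G v) ≡ 0ℚ
    onVertices v rewrite splitAt-↑ˡ (nV G) v (nE G) = *-zeroˡ (z (vtx G v))
    onEdges : ∀ e → isEdge (edg G e) * z (edg G e) ≡ z (edg G e)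
    onEdges e rewrite splitAt-↑ʳ (nV G) (nE G) e = *-identityˡ (z (edg G e))

  Satisfies : ∀ {m} → Vector ℚ m → Constraint m → Set
  Satisfies x c = rhs c ≤ Σℚ (λ i → coef c i * x i)

  InK-cong : ∀ {m} {cs : List (Constraint m)} {a a′ : ℚ} {z z′ : Vector ℚ m} →
    a ≡ a′ → (∀ i → z i ≡ z′ i) → InK cs a z → InK cs a′ z′
  InK-cong refl z≗z′ (0≤a , rows) =
    0≤a , All.map (λ {c} → subst (_ ≤_) (Σℚ-cong λ i → cong (coef c i *_) (z≗z′ i))) rows

  InK-scale : ∀ {m} {cs : List (Constraint m)} {x : Vector ℚ m} {k : ℚ} →
    0ℚ ≤ k → All (Satisfies x) cs → InK cs k (λ i → x i * k)
  InK-scale {x = x} {k} 0≤k x∈P = 0≤k , All.map (λ {c} → scale c) x∈P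
    where
    open ≤-Reasoning
    scale : ∀ c → Satisfies x c → rhs c * k ≤ Σℚ (λ i → coef c i * (x i * k))
    scale c c-sat = begin
      rhs c * k                            ≤⟨ *-monoʳ-≤-nonNeg k {{ℚ.nonNegative 0≤k}} c-sat ⟩
      Σℚ (λ i → coef c i * x i) * k        ≡⟨ cong (_* k) (Σℚ≡sum (λ i → coef c i * x i)) ⟩
      sum (λ i → coef c i * x i) * k       ≡⟨ *-distribʳ-sum k (λ i → coef c i * x i) ⟩
      sum (λ i → coef c i * x i * k)       ≡⟨ sum-cong-≗ (λ i → *-assoc (coef c i) (x i) k) ⟩
      sum (λ i → coef c i * (x i * k))     ≡⟨ Σℚ≡sum (λ i → coef c i * (x i * k)) ⟨
      Σℚ (λ i → coef c i * (x i * k))      ∎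

  module _ (G : Graph) (t : ℕ) {z∅ : ℚ} {z : Vector ℚ (Ground G)} (z∈K : InK (PtConstraints G t) z∅ z) where

    private
      edgeRows = ++⁻ˡ (map _ (allFin (nE G))) (proj₂ z∈K)
      otherRows = ++⁻ʳ (map _ (allFin (nE G))) (proj₂ z∈K)

    InK-Pt-edge : ∀ e → z (edg G e) ≤ z (vtx G (proj₁ (ends G e))) + z (vtx G (proj₂ (ends G e)))
    InK-Pt-edge e = 0≤p-q⇒q≤p (subst₂ _≤_ (*-zeroˡ z∅) (Σℚ-edge _ _ _ z) (tabulate⁻ (map⁻ edgeRows) e))

    InK-Pt-cover : ℕ→ℚ t * z∅ ≤ Σℚ (λ e → z (edg G e))
    InK-Pt-cover = subst (ℕ→ℚ t * z∅ ≤_) (Σℚ-isEdge G z) (All.head otherRows)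

    InK-Pt-nonneg : ∀ q → 0ℚ ≤ z q
    InK-Pt-nonneg q = subst₂ _≤_ (*-zeroˡ z∅) (Σℚ-ind* q z)
      (All.head (tabulate⁻ (map⁻ (concat⁻ (All.tail otherRows))) q))

  satisfies-Pt : ∀ G t {x : Vector ℚ (Ground G)} →
    (∀ e → x (edg G e) ≤ x (vtx G (proj₁ (ends G e))) + x (vtx G (proj₂ (ends G e)))) →
    ℕ→ℚ t ≤ Σℚ (λ e → x (edg G e)) → (∀ q → 0ℚ ≤ x q) → (∀ q → x q ≤ 1ℚ) →
    All (Satisfies x) (PtConstraints G t)
  satisfies-Pt G t {x} edge cover nonneg ≤1 =
    ++⁺ (map⁺ (tabulate⁺ edgeRow)) (coverRow ∷ concat⁺ (map⁺ (tabulate⁺ λ q → nonnegRow q ∷ ≤1Row q ∷ [])))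
    where
    edgeRow : ∀ e → 0ℚ ≤ Σℚ (λ p → (ind (vtx G (proj₁ (ends G e))) p + ind (vtx G (proj₂ (ends G e))) p
                                     + - ind (edg G e) p) * x p)
    edgeRow e = subst (0ℚ ≤_) (sym (Σℚ-edge _ _ _ x)) (q≤p⇒0≤p-q (edge e))
    coverRow : ℕ→ℚ t ≤ Σℚ (λ p → [ (λ _ → 0ℚ) , (λ _ → 1ℚ) ] (splitAt (nV G) p) * x p)
    coverRow = subst (ℕ→ℚ t ≤_) (sym (Σℚ-isEdge G x)) cover
    nonnegRow : ∀ q → 0ℚ ≤ Σℚ (λ p → ind q p * x p)
    nonnegRow q = subst (0ℚ ≤_) (sym (Σℚ-ind* q x)) (nonneg q)
    ≤1Row : ∀ q → - 1ℚ ≤ Σℚ (λ p → - ind q p * x p)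
    ≤1Row q = subst (- 1ℚ ≤_) (sym (Σℚ-neg-ind* q x)) (neg-antimono-≤ (≤1 q))

  subsetsOf-⊥ : ∀ {m} → subsetsOf {m} ⊥ ≡ ⊥ ∷ []
  subsetsOf-⊥ {zero} = refl
  subsetsOf-⊥ {suc m} rewrite subsetsOf-⊥ {m} = refl

  subsetsOf-⁅⁆ : ∀ {m} (i : Fin m) → subsetsOf ⁅ i ⁆ ≡ ⊥ ∷ ⁅ i ⁆ ∷ []
  subsetsOf-⁅⁆ {suc m} zero rewrite subsetsOf-⊥ {m} = refl
  subsetsOf-⁅⁆ (suc i) rewrite subsetsOf-⁅⁆ i = refl

  column-⊥ : ∀ {m} (y : Subset m → ℚ) Y A → column y Y ⊥ A ≡ y (A ∪ Y)
  column-⊥ {m} y Y A rewrite subsetsOf-⊥ {m} | ∣⊥∣≡0 m | ∪-identityʳ Y =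
    trans (+-identityʳ _) (*-identityˡ _)

  column-⊥-⁅⁆ : ∀ {m} (y : Subset m → ℚ) c A → column y ⊥ ⁅ c ⁆ A ≡ y A - y (A ∪ ⁅ c ⁆)
  column-⊥-⁅⁆ {m} y c A
    rewrite subsetsOf-⁅⁆ c | ∣⊥∣≡0 m | ∣⁅x⁆∣≡1 c | ∪-identityʳ {m} ⊥ | ∪-identityʳ A | ∪-identityˡ ⁅ c ⁆ =
    solve 2 (λ a b → con 1ℚ :* a :+ ((:- con 1ℚ) :* b :+ con 0ℚ) := a :- b) refl (y A) (y (A ∪ ⁅ c ⁆))

  module _ {m} {cs : List (Constraint m)} {x : Vector ℚ m} (x∈SA : SA 1 cs x) (c : Fin m) where

    private
      y = proj₁ x∈SA
      y⊥≡1 = proj₁ (proj₂ x∈SA)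
      y⁅⁆≡x = proj₁ (proj₂ (proj₂ x∈SA))
      cone = proj₂ (proj₂ (proj₂ x∈SA))
      ∣⁅c⁆∣≤1 : ∀ {S} → S ≡ ⁅ c ⁆ → ∣ S ∣ ℕ.≤ 1
      ∣⁅c⁆∣≤1 refl = ℕ.≤-reflexive (∣⁅x⁆∣≡1 c)

    SA¹-excluding : InK cs (1ℚ - x c) (λ q → x q - y (⁅ q ⁆ ∪ ⁅ c ⁆))
    SA¹-excluding = InK-cong
      (trans (column-⊥-⁅⁆ y c ⊥) (cong₂ _-_ y⊥≡1 (trans (cong y (∪-identityˡ ⁅ c ⁆)) (y⁅⁆≡x c))))
      (λ q → trans (column-⊥-⁅⁆ y c ⁅ q ⁆) (cong (_- y (⁅ q ⁆ ∪ ⁅ c ⁆)) (y⁅⁆≡x q)))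
      (cone ⊥ ⁅ c ⁆ (∣⁅c⁆∣≤1 (∪-identityˡ ⁅ c ⁆)))

    SA¹-including : InK cs (x c) (λ q → y (⁅ q ⁆ ∪ ⁅ c ⁆))
    SA¹-including = InK-cong
      (trans (column-⊥ y ⁅ c ⁆ ⊥) (trans (cong y (∪-identityˡ ⁅ c ⁆)) (y⁅⁆≡x c)))
      (column-⊥ y ⁅ c ⁆ ∘ ⁅_⁆)
      (cone ⁅ c ⁆ ⊥ (∣⁅c⁆∣≤1 (∪-identityʳ ⁅ c ⁆)))

  star-SA¹⇒1≤vertexSum : ∀ {n t} → 1 ℕ.≤ t → ∀ x →
    SA 1 (PtConstraints (star n) t) x → 1ℚ ≤ vertexSum (star n) x
  star-SA¹⇒1≤vertexSum {n} {t} 1≤t x x∈SA@(y , _ , y⁅⁆≡x , _) = begin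
    1ℚ                                  ≤⟨ p-q≤r⇒p≤r+q excluded≤leaves ⟩
    Σℚ (x ∘ leaf) + x centre            ≡⟨ cong (_+ x centre) (Σℚ≡sum (x ∘ leaf)) ⟩
    sum (x ∘ leaf) + x centre           ≡⟨ sum-init-last (λ v → x (v ↑ˡ n)) ⟨
    sum (λ v → x (v ↑ˡ n))              ≡⟨ Σℚ≡sum (λ v → x (v ↑ˡ n)) ⟨
    vertexSum (star n) x                ∎
    where
    open ≤-Reasoning
    centre = Fin.fromℕ n ↑ˡ n
    leaf : Fin n → Fin (Ground (star n))
    leaf i = Fin.inject₁ i ↑ˡ n
    w∅ = 1ℚ - x centre
    w : Fin (Ground (star n)) → ℚ
    w q = x q - y (⁅ q ⁆ ∪ ⁅ centre ⁆)
    w∈K : InK (PtConstraints (star n) t) w∅ w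
    w∈K = SA¹-excluding x∈SA centre
    z∈K : InK (PtConstraints (star n) t) (x centre) (λ q → y (⁅ q ⁆ ∪ ⁅ centre ⁆))
    z∈K = SA¹-including x∈SA centre

    w-centre≡0 : w centre ≡ 0ℚ
    w-centre≡0 = trans (cong (λ A → x centre - y A) (∪-idem ⁅ centre ⁆))
                       (trans (cong (λ v → x centre - v) (y⁅⁆≡x centre)) (+-inverseʳ (x centre)))

    w-edge≤x-leaf : ∀ i → w (edg (star n) i) ≤ x (leaf i)
    w-edge≤x-leaf i = begin
      w (edg (star n) i)       ≤⟨ InK-Pt-edge (star n) t w∈K i ⟩
      w centre + w (leaf i)    ≡⟨ cong (_+ w (leaf i)) w-centre≡0 ⟩
      0ℚ + w (leaf i)          ≡⟨ +-identityˡ (w (leaf i)) ⟩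
      w (leaf i)               ≤⟨ 0≤q⇒p-q≤p (x (leaf i)) (InK-Pt-nonneg (star n) t z∈K (leaf i)) ⟩
      x (leaf i)               ∎

    excluded≤leaves : w∅ ≤ Σℚ (x ∘ leaf)
    excluded≤leaves = begin
      w∅                        ≡⟨ *-identityˡ w∅ ⟨
      1ℚ * w∅                   ≤⟨ *-monoʳ-≤-nonNeg w∅ {{ℚ.nonNegative (proj₁ w∈K)}} (ℕ→ℚ-mono-≤ 1≤t) ⟩
      ℕ→ℚ t * w∅                ≤⟨ InK-Pt-cover (star n) t w∈K ⟩
      Σℚ (w ∘ edg (star n))     ≡⟨ Σℚ≡sum (w ∘ edg (star n)) ⟩
      sum (w ∘ edg (star n))    ≤⟨ sum-mono-≤ w-edge≤x-leaf ⟩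
      sum (x ∘ leaf)            ≡⟨ Σℚ≡sum (x ∘ leaf) ⟨
      Σℚ (x ∘ leaf)             ∎

  _⊆ᵇ_ : ∀ {m} → Subset m → Subset m → Bool
  [] ⊆ᵇ [] = true
  (a ∷ A) ⊆ᵇ (s ∷ S) = (not a ∨ s) ∧ (A ⊆ᵇ S)

  ⊥⊆ᵇ : ∀ {m} (s : Subset m) → ⊥ ⊆ᵇ s ≡ true
  ⊥⊆ᵇ [] = refl
  ⊥⊆ᵇ (s ∷ S) = ⊥⊆ᵇ S

  ⁅⁆⊆ᵇ : ∀ {m} (i : Fin m) (s : Subset m) → ⁅ i ⁆ ⊆ᵇ s ≡ Vec.lookup s i
  ⁅⁆⊆ᵇ zero (s ∷ S) = trans (cong (s ∧_) (⊥⊆ᵇ S)) (∧-identityʳ s)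
  ⁅⁆⊆ᵇ (suc i) (s ∷ S) = ⁅⁆⊆ᵇ i S

  ∪⊆ᵇ : ∀ {m} (A B s : Subset m) → (A ∪ B) ⊆ᵇ s ≡ (A ⊆ᵇ s) ∧ (B ⊆ᵇ s)
  ∪⊆ᵇ [] [] [] = refl
  ∪⊆ᵇ (a ∷ A) (b ∷ B) (s ∷ S) = begin
    (not (a ∨ b) ∨ s) ∧ ((A ∪ B) ⊆ᵇ S)                  ≡⟨ cong₂ _∧_ (coordinate a b) (∪⊆ᵇ A B S) ⟩
    ((not a ∨ s) ∧ (not b ∨ s)) ∧ ((A ⊆ᵇ S) ∧ (B ⊆ᵇ S)) ≡⟨ ∧-interchange (not a ∨ s) (not b ∨ s) _ _ ⟩
    ((not a ∨ s) ∧ (A ⊆ᵇ S)) ∧ ((not b ∨ s) ∧ (B ⊆ᵇ S)) ∎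
    where
    open ≡-Reasoning
    coordinate : ∀ a b → not (a ∨ b) ∨ s ≡ (not a ∨ s) ∧ (not b ∨ s)
    coordinate true true = sym (∧-idem s)
    coordinate true false = sym (∧-identityʳ s)
    coordinate false b = refl

  moments : ∀ {m} → Subset m → Subset m → ℚ
  moments s A = 𝟙 (A ⊆ᵇ s)

  column-moments : ∀ {m} (s Y N A : Subset m) →
    column (moments s) Y N A ≡ moments s A * column (moments s) Y N ⊥
  column-moments s Y N A =
    trans (cong sumℚ (map-cong factor (subsetsOf N))) (sumℚ-map-*ˡ (moments s A) summand (subsetsOf N))
    where
    summand : Subset _ → ℚ
    summand T = sign ∣ T ∣ * moments s (⊥ ∪ (Y ∪ T))
    factor : ∀ T → sign ∣ T ∣ * moments s (A ∪ (Y ∪ T)) ≡ moments s A * summand T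
    factor T rewrite ∪⊆ᵇ A (Y ∪ T) s | 𝟙-∧ (A ⊆ᵇ s) ((Y ∪ T) ⊆ᵇ s) | ∪-identityˡ (Y ∪ T) =
      solve 3 (λ σ a b → σ :* (a :* b) := a :* (σ :* b)) refl (sign ∣ T ∣) (moments s A) (moments s (Y ∪ T))

  module _ {m} (b y : Bool) (s Y : Subset m) where

    private
      f : Subset (suc m) → ℚ
      f T = sign ∣ T ∣ * moments (b ∷ s) (⊥ ∪ ((y ∷ Y) ∪ T))

      g : Subset m → ℚ
      g T = sign ∣ T ∣ * moments s (⊥ ∪ (Y ∪ T))

      k₀ k₁ : ℚ
      k₀ = 𝟙 (not (y ∨ false) ∨ b)
      k₁ = 𝟙 (not (y ∨ true) ∨ b)

      R : Subset m → Bool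
      R T = (⊥ ∪ (Y ∪ T)) ⊆ᵇ s

      sum-∷ : ∀ t (k : ℚ) N → (∀ T → f (t ∷ T) ≡ k * g T) →
        sumℚ (map f (map (t ∷_) (subsetsOf N))) ≡ k * column (moments s) Y N ⊥
      sum-∷ t k N f≡kg = begin
        sumℚ (map f (map (t ∷_) (subsetsOf N))) ≡⟨ cong sumℚ (map-∘ (subsetsOf N)) ⟨
        sumℚ (map (f ∘ (t ∷_)) (subsetsOf N))   ≡⟨ cong sumℚ (map-cong f≡kg (subsetsOf N)) ⟩
        sumℚ (map (λ T → k * g T) (subsetsOf N)) ≡⟨ sumℚ-map-*ˡ k g (subsetsOf N) ⟩
        k * column (moments s) Y N ⊥            ∎
        where open ≡-Reasoning

      f-false : ∀ T → f (false ∷ T) ≡ k₀ * g T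
      f-false T rewrite 𝟙-∧ (not (y ∨ false) ∨ b) (R T) =
        solve 3 (λ σ a r → σ :* (a :* r) := a :* (σ :* r)) refl (sign ∣ T ∣) k₀ (𝟙 (R T))

      f-true : ∀ T → f (true ∷ T) ≡ - k₁ * g T
      f-true T rewrite 𝟙-∧ (not (y ∨ true) ∨ b) (R T) =
        solve 3 (λ σ a r → (:- σ) :* (a :* r) := (:- a) :* (σ :* r)) refl (sign ∣ T ∣) k₁ (𝟙 (R T))

      weight-false : ∀ y′ b′ → 𝟙 (not (y′ ∨ false) ∨ b′) ≡ 𝟙 ((not y′ ∨ b′) ∧ not (false ∧ b′))
      weight-false true true = refl
      weight-false true false = refl
      weight-false false _ = refl

      weight-true : ∀ y′ b′ →
        𝟙 (not (y′ ∨ false) ∨ b′) - 𝟙 (not (y′ ∨ true) ∨ b′) ≡ 𝟙 ((not y′ ∨ b′) ∧ not (true ∧ b′))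
      weight-true true true = refl
      weight-true true false = refl
      weight-true false true = refl
      weight-true false false = refl

    column-moments-∷ : ∀ n N →
      column (moments (b ∷ s)) (y ∷ Y) (n ∷ N) ⊥ ≡ 𝟙 ((not y ∨ b) ∧ not (n ∧ b)) * column (moments s) Y N ⊥
    column-moments-∷ false N =
      trans (sum-∷ false k₀ N f-false) (cong (_* column (moments s) Y N ⊥) (weight-false y b))
    column-moments-∷ true N = begin
      sumℚ (map f (map (false ∷_) (subsetsOf N) ++ map (true ∷_) (subsetsOf N)))
        ≡⟨ cong sumℚ (map-++ f (map (false ∷_) (subsetsOf N)) _) ⟩
      sumℚ (map f (map (false ∷_) (subsetsOf N)) ++ map f (map (true ∷_) (subsetsOf N)))
        ≡⟨ sumℚ-++ (map f (map (false ∷_) (subsetsOf N))) _ ⟩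
      sumℚ (map f (map (false ∷_) (subsetsOf N))) + sumℚ (map f (map (true ∷_) (subsetsOf N)))
        ≡⟨ cong₂ _+_ (sum-∷ false k₀ N f-false) (sum-∷ true (- k₁) N f-true) ⟩
      k₀ * C + - k₁ * C
        ≡⟨ *-distribʳ-+ C k₀ (- k₁) ⟨
      (k₀ - k₁) * C
        ≡⟨ cong (_* C) (weight-true y b) ⟩
      𝟙 ((not y ∨ b) ∧ not (true ∧ b)) * C ∎
      where
      open ≡-Reasoning
      C = column (moments s) Y N ⊥

  column-moments-nonneg : ∀ {m} (s Y N : Subset m) → 0ℚ ≤ column (moments s) Y N ⊥
  column-moments-nonneg [] [] [] = ≤ᵇ⇒≤ _
  column-moments-nonneg (b ∷ s) (y ∷ Y) (n ∷ N) =
    subst (0ℚ ≤_) (sym (column-moments-∷ b y s Y n N))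
      (0≤p*q (0≤𝟙 ((not y ∨ b) ∧ not (n ∧ b))) (column-moments-nonneg s Y N))

  integral∈SA : ∀ {m} r (cs : List (Constraint m)) (σ : Fin m → Bool) →
    All (Satisfies (𝟙 ∘ σ)) cs → SA r cs (𝟙 ∘ σ)
  integral∈SA r cs σ σ∈P = moments s , cong 𝟙 (⊥⊆ᵇ s) , moments-⁅⁆ , cone
    where
    s = Vec.tabulate σ
    moments-⁅⁆ : ∀ i → moments s ⁅ i ⁆ ≡ 𝟙 (σ i)
    moments-⁅⁆ i = cong 𝟙 (trans (⁅⁆⊆ᵇ i s) (lookup∘tabulate σ i))
    cone : ∀ Y N → ∣ Y ∪ N ∣ ℕ.≤ r →
      InK cs (column (moments s) Y N ⊥) (λ i → column (moments s) Y N ⁅ i ⁆)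
    cone Y N _ = InK-cong refl
      (λ i → sym (trans (column-moments s Y N ⁅ i ⁆) (cong (_* column (moments s) Y N ⊥) (moments-⁅⁆ i))))
      (InK-scale (column-moments-nonneg s Y N) σ∈P)

  covers : (G : Graph) → Subset (nV G) → Fin (nE G) → Bool
  covers G S e = Vec.lookup S (proj₁ (ends G e)) ∨ Vec.lookup S (proj₂ (ends G e))

  coverVector : (G : Graph) → Subset (nV G) → Fin (Ground G) → Bool
  coverVector G S p = [ Vec.lookup S , covers G S ] (splitAt (nV G) p)

  module _ (G : Graph) (S : Subset (nV G)) where

    coverVector-vtx : ∀ v → coverVector G S (vtx G v) ≡ Vec.lookup S v
    coverVector-vtx v = cong [ Vec.lookup S , covers G S ] (splitAt-↑ˡ (nV G) v (nE G))

    coverVector-edg : ∀ e → coverVector G S (edg G e) ≡ covers G S e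
    coverVector-edg e = cong [ Vec.lookup S , covers G S ] (splitAt-↑ʳ (nV G) (nE G) e)

    ℕ→ℚ-covered : ℕ→ℚ (covered G S) ≡ Σℚ (λ e → 𝟙 (coverVector G S (edg G e)))
    ℕ→ℚ-covered = begin
      ℕ→ℚ (covered G S)                           ≡⟨ ℕ→ℚ-sum (map count (allFin (nE G))) ⟩
      sumℚ (map ℕ→ℚ (map count (allFin (nE G))))  ≡⟨ cong sumℚ (map-∘ (allFin (nE G))) ⟨
      Σℚ (ℕ→ℚ ∘ count)                            ≡⟨ Σℚ-cong (λ e → ℕ→ℚ-if (covers G S e)) ⟩
      Σℚ (𝟙 ∘ covers G S)                         ≡⟨ Σℚ-cong (cong 𝟙 ∘ sym ∘ coverVector-edg) ⟩
      Σℚ (λ e → 𝟙 (coverVector G S (edg G e)))    ∎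
      where
      open ≡-Reasoning
      count : Fin (nE G) → ℕ
      count e = if covers G S e then 1 else 0
      ℕ→ℚ-if : ∀ b → ℕ→ℚ (if b then 1 else 0) ≡ 𝟙 b
      ℕ→ℚ-if true = refl
      ℕ→ℚ-if false = refl

    vertexSum-coverVector : vertexSum G (𝟙 ∘ coverVector G S) ≡ ℕ→ℚ ∣ S ∣
    vertexSum-coverVector = begin
      Σℚ (λ v → 𝟙 (coverVector G S (vtx G v)))  ≡⟨ Σℚ-cong (cong 𝟙 ∘ coverVector-vtx) ⟩
      Σℚ (𝟙 ∘ Vec.lookup S)                     ≡⟨ Σℚ≡sum (𝟙 ∘ Vec.lookup S) ⟩
      sum (𝟙 ∘ Vec.lookup S)                    ≡⟨ sum-𝟙-lookup S ⟩
      ℕ→ℚ ∣ S ∣                                 ∎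
      where open ≡-Reasoning

    coverVector∈Pt : ∀ {t} → IsPartialVC G t S → All (Satisfies (𝟙 ∘ coverVector G S)) (PtConstraints G t)
    coverVector∈Pt {t} S-covers = satisfies-Pt G t edge (subst (_ ≤_) ℕ→ℚ-covered (ℕ→ℚ-mono-≤ S-covers))
      (0≤𝟙 ∘ coverVector G S) (𝟙≤1 ∘ coverVector G S)
      where
      edge : ∀ e → 𝟙 (coverVector G S (edg G e)) ≤ 𝟙 (coverVector G S (vtx G (proj₁ (ends G e))))
                                                   + 𝟙 (coverVector G S (vtx G (proj₂ (ends G e))))
      edge e
        rewrite coverVector-edg e | coverVector-vtx (proj₁ (ends G e)) | coverVector-vtx (proj₂ (ends G e)) =
        𝟙-∨-≤ (Vec.lookup S (proj₁ (ends G e))) (Vec.lookup S (proj₂ (ends G e)))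

  ∣p∣≡0⇒p≡⊥ : ∀ {m} (p : Subset m) → ∣ p ∣ ≡ 0 → p ≡ ⊥
  ∣p∣≡0⇒p≡⊥ [] _ = refl
  ∣p∣≡0⇒p≡⊥ (false ∷ p) ∣p∣≡0 = cong (false ∷_) (∣p∣≡0⇒p≡⊥ p ∣p∣≡0)

  covered-⊥ : ∀ G → covered G ⊥ ≡ 0
  covered-⊥ G = trans (sumℕ-map-const uncovered (allFin (nE G))) (ℕ.*-zeroʳ (List.length (allFin (nE G))))
    where
    uncovered : ∀ e → (if covers G ⊥ e then 1 else 0) ≡ 0
    uncovered e rewrite lookup-replicate (proj₁ (ends G e)) false | lookup-replicate (proj₂ (ends G e)) false =
      refl

  partialVC-nonempty : ∀ G {t} S → 1 ℕ.≤ t → IsPartialVC G t S → 1 ℕ.≤ ∣ S ∣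
  partialVC-nonempty G {t} S 1≤t S-covers = ℕ.n≢0⇒n>0 λ ∣S∣≡0 → ℕ.1+n≰n (1≤0 ∣S∣≡0)
    where
    open ℕ.≤-Reasoning
    1≤0 : ∣ S ∣ ≡ 0 → 1 ℕ.≤ 0
    1≤0 ∣S∣≡0 = begin
      1               ≤⟨ 1≤t ⟩
      t               ≤⟨ S-covers ⟩
      covered G S     ≡⟨ cong (covered G) (∣p∣≡0⇒p≡⊥ S ∣S∣≡0) ⟩
      covered G ⊥     ≡⟨ covered-⊥ G ⟩
      0               ∎

  covered-star-centre : ∀ n → covered (star n) ⁅ Fin.fromℕ n ⁆ ≡ n
  covered-star-centre n = begin
    covered (star n) ⁅ Fin.fromℕ n ⁆   ≡⟨ sumℕ-map-const centre-covers (allFin n) ⟩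
    List.length (allFin n) ℕ.* 1       ≡⟨ ℕ.*-identityʳ _ ⟩
    List.length (allFin n)             ≡⟨ length-tabulate id ⟩
    n                                  ∎
    where
    open ≡-Reasoning
    centre-covers : ∀ e → (if covers (star n) ⁅ Fin.fromℕ n ⁆ e then 1 else 0) ≡ 1
    centre-covers e rewrite []=⇒lookup (x∈⁅x⁆ (Fin.fromℕ n)) = refl

open Lemmas
open import Data.Nat using (ℕ; _≤_)
open import Data.Fin using (fromℕ)
open import Data.Fin.Subset using (⁅_⁆)
open import Data.Fin.Subset.Properties using (∣⁅x⁆∣≡1)
open import Data.Product using (Σ-syntax; _×_; _,_)
open import Function using (_∘_)
open import Relation.Binary.PropositionalEquality using (_≡_; refl; sym; trans; cong; subst)

proposition2 : (n t : ℕ) → 1 ≤ n → 1 ≤ t → t ≤ n →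
    Σ[ k ∈ ℕ ] (IsMinPVCSize (star n) t k × SAMinEquals 1 (star n) t (ℕ→ℚ k) × k ≡ 1)
proposition2 n t _ 1≤t t≤n =
  1 , ((S , S-covers , ∣⁅x⁆∣≡1 (fromℕ n)) , λ S′ → partialVC-nonempty (star n) S′ 1≤t)
    , ((𝟙 ∘ coverVector (star n) S , integral∈SA 1 _ _ (coverVector∈Pt (star n) S S-covers)
       , trans (vertexSum-coverVector (star n) S) (cong ℕ→ℚ (∣⁅x⁆∣≡1 (fromℕ n))))
      , star-SA¹⇒1≤vertexSum 1≤t)
    , refl
  where
  S = ⁅ fromℕ n ⁆
  S-covers : IsPartialVC (star n) t S
  S-covers = subst (t ≤_) (sym (covered-star-centre n)) t≤n
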